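{- Let $n\ge 1$, let $\mathcal{C}_n$ be the coordinate arrangement in $\mathbb{R}^n$ consisting of the hyperplanes $x_i=0$, $1\le i\le n$, and let $\Bbbk$ be a field and $t\in\Bbbk$. For each face $F$ of $\mathcal{C}_n$ put $\gamma_t^F=(t-1)^{\mathrm{rank}(F)}$ if $F$ is contained in the first orthant $\bigcap_i\{x_i\ge 0\}$, and $\gamma_t^F=0$ otherwise. Then $\gamma_t=\sum_F\gamma_t^F\mathtt{H}_F\in\Bbbk\Sigma[\mathcal{C}_n]$ is characteristic of parameter $t$.
   Context: For a real hyperplane arrangement $\mathcal{A}$ in $V$, the faces are the closures of the nonempty sets obtained by specifying, for each hyperplane, on which open side of it or on it the points lie; $\Sigma[\mathcal{A}]$ is the set of faces. The Tits product $FG$ is the unique face containing $F$ and a small segment starting at a point of the relative interior of $F$ in the direction of a point of the relative interior of $G$. A flat is an intersection of hyperplanes of $\mathcal{A}$ (the empty intersection being $V$). For the coordinate arrangement (a linear arrangement whose minimal flat is $\{0\}$), the rank of a face or a flat is its dimension. The support $\mathrm{supp}(F)$ is the smallest flat containing $F$. The Tits algebra $\Bbbk\Sigma[\mathcal{A}]$ has basis $\{\mathtt{H}_F\}$ with $\mathtt{H}_F\mathtt{H}_G=\mathtt{H}_{FG}$. For $w=\sum_F w^F\mathtt{H}_F$ and a flat $X$, $\chi_X(w)=\sum_{F:\,\mathrm{supp}(F)\subseteq X} w^F$; $w$ is characteristic of parameter $t$ if $\chi_X(w)=t^{\mathrm{rank}(X)}$ for all flats $X$. -}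

module Defs where

open import Level using (Level; _⊔_)
open import Data.Nat using (ℕ; zero; suc)
open import Data.Bool using (Bool; true; false; _∧_; not; if_then_else_)
open import Data.Fin using (Fin)
open import Data.Vec using (Vec; []; _∷_; lookup)
open import Data.List using (List; []; _∷_; map; concatMap; foldr; filterᵇ)
open import Data.Product using (∃)
open import Relation.Nullary using (¬_)
open import Algebra.Bundles using (CommutativeRing)

-- A face is determined by (and determines) its sign vector: for each
-- coordinate i, whether points of the relative interior have x_i > 0,
-- x_i = 0 or x_i < 0.  The face itself is the closure
--   { x | x_i = 0 if σ_i = 0,  σ_i x_i ≥ 0 otherwise }.

data Sign : Set where
  pos  : Sign
  nul  : Sign
  neg  : Sign

Face : ℕ → Set
Face n = Vec Sign n

allFaces : (n : ℕ) → List (Face n)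
allFaces zero    = [] ∷ []
allFaces (suc n) = concatMap (λ F → (pos ∷ F) ∷ (nul ∷ F) ∷ (neg ∷ F) ∷ []) (allFaces n)

isNul : Sign → Bool
isNul nul = true
isNul _   = false

isNeg : Sign → Bool
isNeg neg = true
isNeg _   = false

rankFace : {n : ℕ} → Face n → ℕ
rankFace []       = zero
rankFace (s ∷ F)  = if isNul s then rankFace F else suc (rankFace F)

-- F ⊆ first orthant ⋂_i {x_i ≥ 0}  iff no sign is negative
inFirstOrthant : {n : ℕ} → Face n → Bool
inFirstOrthant []      = true
inFirstOrthant (s ∷ F) = not (isNeg s) ∧ inFirstOrthant F

-- Flats: a flat is an intersection of hyperplanes; it is given by the
-- set T ⊆ {1..n} of hyperplanes intersected:  X_T = { x | x_i = 0, i ∈ T }.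
-- (T = ∅ gives V; distinct T give distinct flats.)

Flat : ℕ → Set
Flat n = Vec Bool n       -- T as characteristic vector

rankFlat : {n : ℕ} → Flat n → ℕ
rankFlat []       = zero
rankFlat (b ∷ T)  = if b then rankFlat T else suc (rankFlat T)

-- supp(F) ⊆ X_T  iff  F ⊆ X_T  iff  σ_i = 0 for every i ∈ T
suppIn : {n : ℕ} → Face n → Flat n → Bool
suppIn []      []      = true
suppIn (s ∷ F) (b ∷ T) = (if b then isNul s else true) ∧ suppIn F T

record IsField {c ℓ : Level} (R : CommutativeRing c ℓ) : Set (c ⊔ ℓ) where
  open CommutativeRing R
  field
    1≉0 : ¬ (1# ≈ 0#)
    inverse : ∀ x → ¬ (x ≈ 0#) → ∃ λ y → x * y ≈ 1#

-- Tits algebra kΣ[C_n]: an element w = Σ_F w^F H_F is given by its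
-- coefficient function F ↦ w^F.

module TitsAlgebra {c ℓ : Level} (R : CommutativeRing c ℓ) where
  open CommutativeRing R

  pow : Carrier → ℕ → Carrier
  pow x zero    = 1#
  pow x (suc k) = x * pow x k

  sumList : List Carrier → Carrier
  sumList = foldr _+_ 0#

  TitsElem : ℕ → Set c
  TitsElem n = Face n → Carrier

  χ : {n : ℕ} → Flat n → TitsElem n → Carrier
  χ {n} X w = sumList (map w (filterᵇ (λ F → suppIn F X) (allFaces n)))

  IsCharacteristic : {n : ℕ} → Carrier → TitsElem n → Set ℓ
  IsCharacteristic {n} t w = (X : Flat n) → χ X w ≈ pow t (rankFlat X)

  γ : {n : ℕ} → Carrier → TitsElem n
  γ t F = if inFirstOrthant F then pow (t - 1#) (rankFace F) else 0#

{-# OPTIONS --safe #-}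
-- χ_X(γ_t) factors over the coordinates.  A face of C_n is a choice of
-- sign in {+, 0, −} for each coordinate, and the restriction of γ_t to
-- the faces supported in X is a product of one weight per coordinate:
-- a coordinate on which X vanishes admits only the sign 0, with weight 1;
-- a free coordinate admits + with weight t − 1, 0 with weight 1 and − with
-- weight 0, in total t.  Hence χ_X(γ_t) = t ^ (number of free coordinates)
-- = t ^ rank X, over any commutative ring and for every n.
module Submission where

open import Defs
open import Level using (Level)
open import Data.Nat using (ℕ; suc; _≤_)
open import Data.Bool using (Bool; true; false; if_then_else_)
open import Data.List using (List; []; _∷_; _++_; map; concatMap; foldr; filterᵇ)
open import Data.List.Properties using (map-++; map-∘)
open import Data.Vec using ([]; _∷_)
open import Relation.Binary.PropositionalEquality using (cong)
open import Algebra.Bundles using (Monoid; Semiring; CommutativeRing)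
import Algebra.Properties.Group as GroupProperties
import Relation.Binary.Reasoning.Setoid as SetoidReasoning

module MonoidListSum {a ℓ} (M : Monoid a ℓ) where
  open Monoid M
  open SetoidReasoning setoid

  sum : List Carrier → Carrier
  sum = foldr _∙_ ε

  sum-++ : ∀ xs ys → sum (xs ++ ys) ≈ sum xs ∙ sum ys
  sum-++ []       ys = sym (identityˡ (sum ys))
  sum-++ (x ∷ xs) ys = trans (∙-congˡ (sum-++ xs ys)) (sym (assoc x (sum xs) (sum ys)))

  module _ {b} {A : Set b} where

    sum-map-cong : {u v : A → Carrier} → (∀ x → u x ≈ v x) →
      ∀ xs → sum (map u xs) ≈ sum (map v xs)
    sum-map-cong u≈v []       = refl
    sum-map-cong u≈v (x ∷ xs) = ∙-cong (u≈v x) (sum-map-cong u≈v xs)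

    sum-map-filterᵇ : (p : A → Bool) (w : A → Carrier) → ∀ xs →
      sum (map w (filterᵇ p xs)) ≈ sum (map (λ x → if p x then w x else ε) xs)
    sum-map-filterᵇ p w []       = refl
    sum-map-filterᵇ p w (x ∷ xs) with p x
    ... | true  = ∙-congˡ (sum-map-filterᵇ p w xs)
    ... | false = trans (sum-map-filterᵇ p w xs) (sym (identityˡ _))

    sum-map-concatMap : ∀ {c} {B : Set c} (f : A → List B) (w : B → Carrier) → ∀ xs →
      sum (map w (concatMap f xs)) ≈ sum (map (λ x → sum (map w (f x))) xs)
    sum-map-concatMap f w []       = refl
    sum-map-concatMap f w (x ∷ xs) = begin
      sum (map w (f x ++ concatMap f xs))               ≡⟨ cong sum (map-++ w (f x) (concatMap f xs)) ⟩
      sum (map w (f x) ++ map w (concatMap f xs))       ≈⟨ sum-++ (map w (f x)) (map w (concatMap f xs)) ⟩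
      sum (map w (f x)) ∙ sum (map w (concatMap f xs))  ≈⟨ ∙-congˡ (sum-map-concatMap f w xs) ⟩
      sum (map w (f x)) ∙ sum (map (λ y → sum (map w (f y))) xs) ∎

module SemiringListSum {a ℓ} (R : Semiring a ℓ) where
  open Semiring R
  open MonoidListSum +-monoid public

  *-distribˡ-sum : ∀ x ys → x * sum ys ≈ sum (map (x *_) ys)
  *-distribˡ-sum x []       = zeroʳ x
  *-distribˡ-sum x (y ∷ ys) = trans (distribˡ x y (sum ys)) (+-congˡ (*-distribˡ-sum x ys))

  *-distribʳ-sum : ∀ x ys → sum ys * x ≈ sum (map (_* x) ys)
  *-distribʳ-sum x []       = zeroˡ x
  *-distribʳ-sum x (y ∷ ys) = trans (distribʳ x y (sum ys)) (+-congˡ (*-distribʳ-sum x ys))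

module CoordinateArrangement {c ℓ} (R : CommutativeRing c ℓ) (t : CommutativeRing.Carrier R) where
  open CommutativeRing R
  open TitsAlgebra R
  open SemiringListSum semiring
  open GroupProperties +-group using (//-rightDividesˡ)
  open SetoidReasoning setoid

  signs : List Sign
  signs = pos ∷ nul ∷ neg ∷ []

  γ↾ : {n : ℕ} → Flat n → TitsElem n
  γ↾ X F = if suppIn F X then γ t F else 0#

  χ-γ≈sum-γ↾ : {n : ℕ} (X : Flat n) → χ X (γ t) ≈ sum (map (γ↾ X) (allFaces n))
  χ-γ≈sum-γ↾ {n} X = sum-map-filterᵇ (λ F → suppIn F X) (γ t) (allFaces n)

  signWeight : Bool → Sign → Carrier
  signWeight _     nul = 1#
  signWeight false pos = t - 1#
  signWeight _     _   = 0#

  γ↾-cons : ∀ {n} b s (X : Flat n) F → γ↾ (b ∷ X) (s ∷ F) ≈ signWeight b s * γ↾ X F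
  γ↾-cons true  pos X F = sym (zeroˡ _)
  γ↾-cons true  neg X F = sym (zeroˡ _)
  γ↾-cons true  nul X F = sym (*-identityˡ _)
  γ↾-cons false nul X F = sym (*-identityˡ _)
  γ↾-cons false neg X F with suppIn F X
  ... | true  = sym (zeroˡ _)
  ... | false = sym (zeroˡ _)
  γ↾-cons false pos X F with suppIn F X | inFirstOrthant F
  ... | true  | true  = refl
  ... | true  | false = sym (zeroʳ _)
  ... | false | _     = sym (zeroʳ _)

  1+[0+0]≈1 : 1# + (0# + 0#) ≈ 1#
  1+[0+0]≈1 = trans (+-congˡ (+-identityˡ 0#)) (+-identityʳ 1#)

  sum-signWeight : ∀ b {n} (X : Flat n) →
    sum (map (signWeight b) signs) * pow t (rankFlat X) ≈ pow t (rankFlat (b ∷ X))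
  sum-signWeight true  X = trans (*-congʳ (trans (+-identityˡ _) 1+[0+0]≈1)) (*-identityˡ _)
  sum-signWeight false X = *-congʳ (trans (+-congˡ 1+[0+0]≈1) (//-rightDividesˡ 1# t))

  sum-γ↾ : {n : ℕ} (X : Flat n) → sum (map (γ↾ X) (allFaces n)) ≈ pow t (rankFlat X)
  sum-γ↾ []      = +-identityʳ 1#
  sum-γ↾ {suc n} (b ∷ X) = begin
    sum (map (γ↾ (b ∷ X)) (allFaces (suc n)))
      ≈⟨ sum-map-concatMap (λ F → map (_∷ F) signs) (γ↾ (b ∷ X)) (allFaces n) ⟩
    sum (map (λ F → sum (map (λ s → γ↾ (b ∷ X) (s ∷ F)) signs)) (allFaces n))
      ≈⟨ sum-map-cong sum-over-signs (allFaces n) ⟩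
    sum (map (λ F → w * γ↾ X F) (allFaces n))
      ≡⟨ cong sum (map-∘ (allFaces n)) ⟩
    sum (map (w *_) (map (γ↾ X) (allFaces n)))
      ≈⟨ *-distribˡ-sum w (map (γ↾ X) (allFaces n)) ⟨
    w * sum (map (γ↾ X) (allFaces n))
      ≈⟨ *-congˡ (sum-γ↾ X) ⟩
    w * pow t (rankFlat X)
      ≈⟨ sum-signWeight b X ⟩
    pow t (rankFlat (b ∷ X)) ∎
    where
      w : Carrier
      w = sum (map (signWeight b) signs)

      sum-over-signs : ∀ F → sum (map (λ s → γ↾ (b ∷ X) (s ∷ F)) signs) ≈ w * γ↾ X F
      sum-over-signs F = begin
        sum (map (λ s → γ↾ (b ∷ X) (s ∷ F)) signs)       ≈⟨ sum-map-cong (λ s → γ↾-cons b s X F) signs ⟩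
        sum (map (λ s → signWeight b s * γ↾ X F) signs)  ≈⟨ *-distribʳ-sum (γ↾ X F) (map (signWeight b) signs) ⟨
        w * γ↾ X F                                       ∎

  γ-isCharacteristic : (n : ℕ) → IsCharacteristic {n} t (γ t)
  γ-isCharacteristic n X = trans (χ-γ≈sum-γ↾ X) (sum-γ↾ X)

mainTheorem6 : {c ℓ : Level} (𝕜 : CommutativeRing c ℓ) → IsField 𝕜 →
    (n : ℕ) → 1 ≤ n → (t : CommutativeRing.Carrier 𝕜) →
    TitsAlgebra.IsCharacteristic 𝕜 {n} t (TitsAlgebra.γ 𝕜 {n} t)
mainTheorem6 𝕜 _ n _ t = CoordinateArrangement.γ-isCharacteristic 𝕜 t n
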